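{- Let $G$ be a graph and $S\subseteq V(G)$. Then $\mathrm{thin}(G)\leq |V(G)|-|S|+\mathrm{thin}(G[S])$.
   Context: Graphs are finite, simple, undirected; $G[S]$ is the subgraph induced by $S$. For a graph $G=(V,E)$, an ordering $v_1,\dots,v_n$ of $V$ and a partition of $V$ are consistent if for every $r<s<t$, whenever $v_r,v_s$ are in the same class and $v_tv_r\in E$, then $v_tv_s\in E$. $\mathrm{thin}(G)$ is the minimum number of classes of a partition of $V$ consistent with some ordering of $V$. -}

module Defs where

open import Data.Nat using (ℕ; _≤_)
open import Data.Fin using (Fin) renaming (_<_ to _<ᶠ_)
open import Data.Fin.Subset using (Subset; _∈_)
open import Data.Product using (Σ; Σ-syntax; _×_; proj₁)
open import Relation.Binary.PropositionalEquality using (_≡_)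
open import Relation.Nullary using (¬_)
open import Function.Bundles using (_↔_; Inverse)

record Graph (V : Set) : Set₁ where
  field
    Adj    : V → V → Set
    sym    : ∀ {u v} → Adj u v → Adj v u
    irrefl : ∀ {v} → ¬ Adj v v
open Graph public

InducedV : ∀ {n} → Subset n → Set
InducedV {n} S = Σ (Fin n) (λ v → v ∈ S)

Induced : ∀ {n} → Graph (Fin n) → (S : Subset n) → Graph (InducedV S)
Induced G S = record
  { Adj    = λ u v → Adj G (proj₁ u) (proj₁ v)
  ; sym    = sym G
  ; irrefl = irrefl G
  }

-- A partition into (at most) k classes is a class map V → Fin k.
Consistent : ∀ {V : Set} (G : Graph V) {m k : ℕ} → (Fin m ↔ V) → (V → Fin k) → Set
Consistent G {m} ord c =
  ∀ (r s t : Fin m) → r <ᶠ s → s <ᶠ t →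
  c (v r) ≡ c (v s) → Adj G (v t) (v r) → Adj G (v t) (v s)
  where v = Inverse.to ord

HasThin : ∀ {V : Set} (G : Graph V) (m k : ℕ) → Set
HasThin {V} G m k = Σ[ ord ∈ (Fin m ↔ V) ] Σ[ c ∈ (V → Fin k) ] Consistent G ord c

IsThin : ∀ {V : Set} (G : Graph V) (m k : ℕ) → Set
IsThin G m k = HasThin G m k × (∀ j → HasThin G m j → k ≤ j)

module Submission where

-- Let a = |V ∖ S| and b = |S|.  Take an ordering of G[S]
-- with a consistent partition into tS classes.  Order V(G) by listing the
-- a vertices outside S first (in increasing order), followed by S in the given
-- order, put every vertex outside S into a class of its own, and keep the
-- classes of G[S] for the vertices of S.  A violation of consistency needs
-- two distinct vertices v_r, v_s (r < s) in one class; a singleton class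
-- has no such pair, and a class of G[S] lies entirely in the suffix, so
-- r, s and every t > s are positions of S, where consistency holds by
-- hypothesis.  This gives thin(G) ≤ a + tS = |V| - |S| + thin(G[S]).

open import Defs
open import Data.Nat using (ℕ; _≤_; _+_; _∸_; _<_)
open import Data.Fin using (Fin)
open import Data.Fin.Subset using (Subset; ∣_∣)

open import Data.Nat.Properties using (<-irrefl; <⇒≱; ≤-trans; <⇒≤; m≤m+n; +-cancelˡ-<; m∸n+n≡m)
open import Data.Fin using (zero; suc; toℕ; splitAt; join; _↑ˡ_; _↑ʳ_) renaming (_<_ to _<ᶠ_)
open import Data.Fin.Properties
  using (toℕ-↑ˡ; toℕ-↑ʳ; toℕ<n; ↑ˡ-injective; ↑ʳ-injective; splitAt-↑ˡ; splitAt-↑ʳ; splitAt⁻¹-↑ˡ; splitAt⁻¹-↑ʳ; +↔⊎)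
open import Data.Fin.Subset using (_∈_; ∁; inside; outside)
open import Data.Fin.Subset.Properties using (_∈?_; x∉p⇒x∈∁p; x∈∁p⇒x∉p; ∣∁p∣≡n∸∣p∣; ∣p∣≤n)
open import Data.Vec using (_∷_; here; there)
open import Data.Product using (_,_; proj₁)
open import Data.Sum as Sum using (_⊎_; inj₁; inj₂; [_,_]′)
open import Data.Sum.Function.Propositional using (_⊎-↔_)
open import Function using (_∘_)
open import Function.Bundles using (_↔_; Inverse; mk↔ₛ′)
open import Function.Construct.Composition using (_↔-∘_)
open import Relation.Nullary using (¬_; yes; no; contradiction)
open import Relation.Binary.PropositionalEquality
  using (_≡_; _≢_; _≗_; refl; trans; cong; subst; subst₂) renaming (sym to ≡-sym)

open Inverse using (to; from)

-- For an ordering `ord`, `Consistent G ord c` is by definition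
-- `SequenceConsistent G (to ord) (c ∘ to ord)`.
SequenceConsistent : ∀ {V : Set} (G : Graph V) {m k : ℕ} →
                     (Fin m → V) → (Fin m → Fin k) → Set
SequenceConsistent G {m} v ℓ =
  ∀ (r s t : Fin m) → r <ᶠ s → s <ᶠ t →
  ℓ r ≡ ℓ s → Adj G (v t) (v r) → Adj G (v t) (v s)

sequenceConsistent-cong : ∀ {V : Set} (G : Graph V) {m k : ℕ} {v w : Fin m → V}
                          (ℓ : Fin m → Fin k) → v ≗ w →
                          SequenceConsistent G v ℓ → SequenceConsistent G w ℓ
sequenceConsistent-cong G ℓ v≗w cons r s t r<s s<t same adj =
  subst₂ (Adj G) (v≗w t) (v≗w s)
    (cons r s t r<s s<t same (subst₂ (Adj G) (≡-sym (v≗w t)) (≡-sym (v≗w r)) adj))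

hasThin-from-sequence : ∀ {V : Set} (G : Graph V) {m k : ℕ} (ord : Fin m ↔ V)
                        (ℓ : Fin m → Fin k) →
                        SequenceConsistent G (to ord) ℓ → HasThin G m k
hasThin-from-sequence G ord ℓ cons =
  ord , ℓ ∘ from ord , λ r s t r<s s<t same →
    cons r s t r<s s<t (subst₂ _≡_ (classOfPosition r) (classOfPosition s) same)
  where
  classOfPosition : ∀ i → ℓ (from ord (to ord i)) ≡ ℓ i
  classOfPosition i = cong ℓ (Inverse.strictlyInverseʳ ord i)

data Position (a b : ℕ) : Fin (a + b) → Set where
  prefix : (x : Fin a) → Position a b (x ↑ˡ b)
  suffix : (y : Fin b) → Position a b (a ↑ʳ y)

position : ∀ a {b} (i : Fin (a + b)) → Position a b i
position a i with splitAt a i in eq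
... | inj₁ x = subst (Position a _) (splitAt⁻¹-↑ˡ eq) (prefix x)
... | inj₂ y = subst (Position a _) (splitAt⁻¹-↑ʳ eq) (suffix y)

↑ˡ≢↑ʳ : ∀ {a b} (x : Fin a) (y : Fin b) → x ↑ˡ b ≢ a ↑ʳ y
↑ˡ≢↑ʳ {a} {b} x y eq
  with () ← trans (≡-sym (splitAt-↑ˡ a x b)) (trans (cong (splitAt a) eq) (splitAt-↑ʳ a b y))

suffix≮prefix : ∀ {a b} (x : Fin a) (y : Fin b) → ¬ (a ↑ʳ y <ᶠ x ↑ˡ b)
suffix≮prefix {a} {b} x y y<x = <⇒≱ (toℕ<n x) a≤x
  where
  a≤x : a ≤ toℕ x
  a≤x = ≤-trans (m≤m+n a (toℕ y))
              (subst₂ _≤_ (toℕ-↑ʳ a y) (toℕ-↑ˡ x b) (<⇒≤ y<x))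

↑ʳ-cancel-< : ∀ a {b} (x y : Fin b) → a ↑ʳ x <ᶠ a ↑ʳ y → x <ᶠ y
↑ʳ-cancel-< a x y lt = +-cancelˡ-< a (toℕ x) (toℕ y) (subst₂ _<_ (toℕ-↑ʳ a x) (toℕ-↑ʳ a y) lt)

-- Labels: the i-th prefix position gets its own class i, a suffix
-- position keeps its class ℓ, shifted past the a singleton classes.
singletonPrefix : ∀ a {b k} → (Fin b → Fin k) → Fin (a + b) → Fin (a + k)
singletonPrefix a {k = k} ℓ = join a k ∘ Sum.map₂ ℓ ∘ splitAt a

singletonPrefix-prefix : ∀ a {b k} (ℓ : Fin b → Fin k) (x : Fin a) →
                         singletonPrefix a ℓ (x ↑ˡ b) ≡ x ↑ˡ k
singletonPrefix-prefix a {b} {k} ℓ x = cong (join a k ∘ Sum.map₂ ℓ) (splitAt-↑ˡ a x b)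

singletonPrefix-suffix : ∀ a {b k} (ℓ : Fin b → Fin k) (y : Fin b) →
                         singletonPrefix a ℓ (a ↑ʳ y) ≡ a ↑ʳ ℓ y
singletonPrefix-suffix a {b} {k} ℓ y = cong (join a k ∘ Sum.map₂ ℓ) (splitAt-↑ʳ a b y)

prepend-singletons : ∀ {V : Set} (G : Graph V) {a b k : ℕ} (v : Fin (a + b) → V)
                     (ℓ : Fin b → Fin k) →
                     SequenceConsistent G (v ∘ (a ↑ʳ_)) ℓ →
                     SequenceConsistent G v (singletonPrefix a ℓ)
prepend-singletons G {a} {b} {k} v ℓ cons r s t r<s s<t same
  with position a r | position a s
... | prefix x | prefix x′ =
  contradiction r<s (<-irrefl (cong (toℕ ∘ (_↑ˡ b)) (↑ˡ-injective k x x′ sameLabel)))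
  where
  sameLabel : x ↑ˡ k ≡ x′ ↑ˡ k
  sameLabel = trans (≡-sym (singletonPrefix-prefix a ℓ x)) (trans same (singletonPrefix-prefix a ℓ x′))
... | prefix x | suffix y′ =
  contradiction (trans (≡-sym (singletonPrefix-prefix a ℓ x)) (trans same (singletonPrefix-suffix a ℓ y′))) (↑ˡ≢↑ʳ x (ℓ y′))
... | suffix y | prefix x′ =
  contradiction (trans (≡-sym (singletonPrefix-prefix a ℓ x′)) (trans (≡-sym same) (singletonPrefix-suffix a ℓ y))) (↑ˡ≢↑ʳ x′ (ℓ y))
... | suffix y | suffix y′ with position a t
...   | prefix z = contradiction s<t (suffix≮prefix z y′)
...   | suffix z =
  cons y y′ z (↑ʳ-cancel-< a y y′ r<s) (↑ʳ-cancel-< a y′ z s<t) (↑ʳ-injective a (ℓ y) (ℓ y′) sameLabel)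
  where
  sameLabel : a ↑ʳ ℓ y ≡ a ↑ʳ ℓ y′
  sameLabel = trans (≡-sym (singletonPrefix-suffix a ℓ y)) (trans same (singletonPrefix-suffix a ℓ y′))

∈-irrelevant : ∀ {n} {x : Fin n} {p : Subset n} (m m′ : x ∈ p) → m ≡ m′
∈-irrelevant here      here       = refl
∈-irrelevant (there m) (there m′) = cong there (∈-irrelevant m m′)

member-≡ : ∀ {n} {p : Subset n} {x : Fin n} (m m′ : x ∈ p) →
           _≡_ {A = InducedV p} (x , m) (x , m′)
member-≡ m m′ = cong (_ ,_) (∈-irrelevant m m′)

enumerate : ∀ {n} (p : Subset n) → Fin ∣ p ∣ ↔ InducedV p
enumerate p = mk↔ₛ′ (element p) (index p) (element-index p) (index-element p)
  where
  element : ∀ {n} (p : Subset n) → Fin ∣ p ∣ → InducedV p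
  element (inside  ∷ p) zero    = zero , here
  element (inside  ∷ p) (suc i) = let (x , m) = element p i in suc x , there m
  element (outside ∷ p) i       = let (x , m) = element p i in suc x , there m

  index : ∀ {n} (p : Subset n) → InducedV p → Fin ∣ p ∣
  index (inside  ∷ p) (zero  , here)    = zero
  index (inside  ∷ p) (suc x , there m) = suc (index p (x , m))
  index (outside ∷ p) (suc x , there m) = index p (x , m)

  element-index : ∀ {n} (p : Subset n) y → element p (index p y) ≡ y
  element-index (inside  ∷ p) (zero  , here)    = refl
  element-index (inside  ∷ p) (suc x , there m) rewrite element-index p (x , m) = refl
  element-index (outside ∷ p) (suc x , there m) rewrite element-index p (x , m) = refl

  index-element : ∀ {n} (p : Subset n) i → index p (element p i) ≡ i
  index-element (inside  ∷ p) zero    = refl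
  index-element (inside  ∷ p) (suc i) = cong suc (index-element p i)
  index-element (outside ∷ p) i       = index-element p i

complement-or-subset : ∀ {n} (S : Subset n) → (InducedV (∁ S) ⊎ InducedV S) ↔ Fin n
complement-or-subset S = mk↔ₛ′ [ proj₁ , proj₁ ]′ side side-vertex vertex-side
  where
  side : ∀ v → InducedV (∁ S) ⊎ InducedV S
  side v with v ∈? S
  ... | yes v∈S = inj₂ (v , v∈S)
  ... | no  v∉S = inj₁ (v , x∉p⇒x∈∁p v∉S)

  side-vertex : ∀ v → [ proj₁ , proj₁ ]′ (side v) ≡ v
  side-vertex v with v ∈? S
  ... | yes _ = refl
  ... | no  _ = refl

  vertex-side : ∀ w → side ([ proj₁ , proj₁ ]′ w) ≡ w
  vertex-side (inj₁ (v , v∈∁S)) with v ∈? S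
  ... | yes v∈S = contradiction v∈S (x∈∁p⇒x∉p v∈∁S)
  ... | no  _   = cong inj₁ (member-≡ _ v∈∁S)
  vertex-side (inj₂ (v , v∈S)) with v ∈? S
  ... | yes _   = cong inj₂ (member-≡ _ v∈S)
  ... | no  v∉S = contradiction v∈S v∉S

complementFirst : ∀ {n} (S : Subset n) → Fin ∣ S ∣ ↔ InducedV S →
                  Fin (∣ ∁ S ∣ + ∣ S ∣) ↔ Fin n
complementFirst S ordS = complement-or-subset S ↔-∘ ((enumerate (∁ S) ⊎-↔ ordS) ↔-∘ +↔⊎)

complementFirst-suffix : ∀ {n} (S : Subset n) (ordS : Fin ∣ S ∣ ↔ InducedV S) →
                         proj₁ ∘ to ordS ≗ to (complementFirst S ordS) ∘ (∣ ∁ S ∣ ↑ʳ_)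
complementFirst-suffix S ordS j =
  cong ([ proj₁ , proj₁ ]′ ∘ Sum.map (to (enumerate (∁ S))) (to ordS)) (≡-sym (splitAt-↑ʳ ∣ ∁ S ∣ ∣ S ∣ j))

∣∁S∣+∣S∣≡n : ∀ {n} (S : Subset n) → ∣ ∁ S ∣ + ∣ S ∣ ≡ n
∣∁S∣+∣S∣≡n S = trans (cong (_+ ∣ S ∣) (∣∁p∣≡n∸∣p∣ S)) (m∸n+n≡m (∣p∣≤n S))

extend-partition : ∀ {n} (G : Graph (Fin n)) (S : Subset n) {k : ℕ} →
                   HasThin (Induced G S) ∣ S ∣ k → HasThin G n ((n ∸ ∣ S ∣) + k)
extend-partition {n} G S {k} (ordS , cS , consS) =
  subst₂ (HasThin G) (∣∁S∣+∣S∣≡n S) (cong (_+ k) (∣∁p∣≡n∸∣p∣ S))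
    (hasThin-from-sequence G ord (singletonPrefix ∣ ∁ S ∣ (cS ∘ to ordS))
      (prepend-singletons G (to ord) (cS ∘ to ordS)
        (sequenceConsistent-cong G (cS ∘ to ordS) (complementFirst-suffix S ordS) consS)))
  where
  ord : Fin (∣ ∁ S ∣ + ∣ S ∣) ↔ Fin n
  ord = complementFirst S ordS

lemma3p14 : (n : ℕ) (G : Graph (Fin n)) (S : Subset n) (t tS : ℕ) →
            IsThin G n t → IsThin (Induced G S) ∣ S ∣ tS →
            t ≤ (n ∸ ∣ S ∣) + tS
lemma3p14 n G S t tS (_ , minimal) (partitionS , _) =
  minimal ((n ∸ ∣ S ∣) + tS) (extend-partition G S partitionS)
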